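{- Let $k,s,p$ be positive integers with $s\geq 1$ and $k,p\geq 2$. For every real $\epsilon>0$ there exists an integer $n_\epsilon$ such that for all $n\geq n_\epsilon$ the following holds: if $\mathcal{H}\subseteq\binom{[n]}{k}$ satisfies $\nu(\mathcal{H})\leq s$ and $$co_p(\mathcal{H})\geq \left(\frac{s-1}{(k-2)!}+\epsilon\right)n^{k+p-2},$$ then $\mathcal{H}$ is the union of $s$ different trivial intersecting families.
   Context: $[n]=\{1,\dots,n\}$, $\binom{[n]}{k}$ is the family of $k$-subsets of $[n]$, and $\nu(\mathcal{H})$ is the largest number of pairwise disjoint members of $\mathcal{H}$. For $E\subseteq[n]$, $d_{\mathcal{H}}(E)=|\{F\in\mathcal{H}:E\subseteq F\}|$, and $co_p(\mathcal{H})=\sum_{E\in\binom{[n]}{k-1}}(d_{\mathcal{H}}(E))^p$. A family is trivial intersecting if the intersection of all its members is nonempty. "$\mathcal{H}$ is the union of $s$ different trivial intersecting families" means $\mathcal{H}=\bigcup_{i=1}^s\mathcal{G}_i$ where each $\mathcal{G}_i$ is a trivial intersecting family with common element $x_i$, the $x_i$ being distinct.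
   Formalization: The parameter ε ranges over the positive rationals instead of the positive reals. -}

module Defs where

open import Data.Nat using (ℕ; zero; suc; _∸_; _^_; _!)
open import Data.Nat.Properties using (_!≢0)
open import Data.Integer using (+_)
open import Data.Rational using (ℚ; _/_; _+_; _*_)
open import Data.Bool using (Bool; true; false)
open import Data.Fin using (Fin)
open import Data.Fin.Subset using (Subset; inside; outside; ∣_∣; _∩_; Empty; _⊆_)
open import Data.Fin.Subset.Properties using (_⊆?_)
open import Data.List using (List; []; _∷_; _++_; map; filter; length)
open import Data.Nat.ListAction using (sum)
open import Data.Vec using ([]; _∷_)
open import Data.Nat using (_≟_)

allSubsets : (n : ℕ) → List (Subset n)
allSubsets zero = [] ∷ []
allSubsets (suc n) = map (inside ∷_) (allSubsets n) ++ map (outside ∷_) (allSubsets n)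

kSubsets : (n r : ℕ) → List (Subset n)
kSubsets n r = filter (λ A → ∣ A ∣ ≟ r) (allSubsets n)

-- A family of subsets of [n] is represented by a duplicate-free list
-- (duplicate-freeness is imposed as a hypothesis in the statement).

deg : {n : ℕ} → List (Subset n) → Subset n → ℕ
deg H E = length (filter (λ F → E ⊆? F) H)

cod : (n k p : ℕ) → List (Subset n) → ℕ
cod n k p H = sum (map (λ E → deg H E ^ p) (kSubsets n (k ∸ 1)))

Disjoint : {n : ℕ} → Subset n → Subset n → Set
Disjoint A B = Empty (A ∩ B)

threshold : (n k s p : ℕ) → ℚ → ℚ
threshold n k s p ε =
  (((+ (s ∸ 1)) / ((k ∸ 2) !)) {{(k ∸ 2) !≢0}} + ε) * ((+ (n ^ (k Data.Nat.+ p ∸ 2))) / 1)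

{-# OPTIONS --safe #-}
-- Write k = r + 2. Call a (k-1)-set heavy if more than D = k + (k+1)s edges contain it, and a
-- vertex big if it lies in more than D·n^(r-1) heavy sets. If s vertices are big, every edge meets
-- one of them: otherwise, starting from an edge avoiding them, one picks for each big vertex v in
-- turn an edge avoiding all vertices used so far. Such an edge exists because v lies in a heavy set
-- avoiding the used vertices (v shares at most n^(r-1) sets with each of them), and each used vertex
-- lies in at most one edge through that heavy set. This yields s + 1 disjoint edges.
-- If fewer than s vertices are big, every heavy set meets the vertex set C of a maximal matching,
-- |C| ≤ sk, so counting through C there are at most (s-1)·n^r/r! + O(n^(r-1)) heavy sets. A light
-- set contributes at most D^p to co_p(H) and a heavy one at most n^p, whence
-- co_p(H) ≤ (s-1)/r!·n^(r+p) + O(n^(r+p-1)), which is below the threshold for large n.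
module Submission where

open import Defs

module ListCounting where

  open import Data.Nat using (ℕ; suc; _+_; _*_; _≤_; z≤n; s≤s)
  open import Data.Nat.Properties
  open import Data.Nat.ListAction using (sum)
  open import Data.Nat.Solver using (module +-*-Solver)
  open +-*-Solver
  open import Algebra.Properties.CommutativeSemigroup +-commutativeSemigroup using (interchange)
  open import Data.Fin using (Fin; zero; suc)
  open import Data.Fin.Properties using (injective⇒≤)
  open import Data.List using (List; []; _∷_; _++_; map; filter; length; lookup)
  open import Data.List.Properties using (length-++; filter-++; filter-none; map-cong)
  open import Data.List.Membership.Propositional using (_∈_)
  open import Data.List.Membership.Propositional.Properties using (∈-filter⁺; ∈-filter⁻; ∈-lookup)
  open import Data.List.Relation.Binary.Subset.Propositional using (_⊆_)
  open import Data.List.Relation.Unary.Any using (Any; here; there)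
  import Data.List.Relation.Unary.Any as Any
  open import Data.List.Relation.Unary.Any.Properties using (lookup-index)
  open import Data.List.Relation.Unary.All using (tabulate)
  import Data.List.Relation.Unary.All as All
  open import Data.List.Relation.Unary.AllPairs using (_∷_)
  open import Data.List.Relation.Unary.Unique.Propositional using (Unique)
  import Data.List.Relation.Unary.Unique.Propositional.Properties as Unique
  open import Data.Product using (_,_)
  open import Data.Empty using (⊥-elim)
  open import Function.Definitions using (Injective)
  open import Relation.Nullary using (Dec; yes; no; ¬_)
  open import Relation.Unary using (Decidable)
  open import Relation.Binary.PropositionalEquality using (_≡_; refl; sym; trans; cong; module ≡-Reasoning)

  private variable
    A B : Set

  count : {P : A → Set} → Decidable P → List A → ℕ
  count P? xs = length (filter P? xs)

  indicator : {X : Set} → Dec X → ℕ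
  indicator (yes _) = 1
  indicator (no _)  = 0

  count-∷ : {P : A → Set} (P? : Decidable P) (x : A) (xs : List A) →
            count P? (x ∷ xs) ≡ indicator (P? x) + count P? xs
  count-∷ P? x xs with P? x
  ... | yes _ = refl
  ... | no _  = refl

  count-++ : {P : A → Set} (P? : Decidable P) (xs ys : List A) →
             count P? (xs ++ ys) ≡ count P? xs + count P? ys
  count-++ P? xs ys rewrite filter-++ P? xs ys = length-++ (filter P? xs)

  count-map : {P : A → Set} (P? : Decidable P) (f : B → A) (xs : List B) →
              count P? (map f xs) ≡ count (λ x → P? (f x)) xs
  count-map P? f [] = refl
  count-map P? f (x ∷ xs) with P? (f x)
  ... | yes _ = cong suc (count-map P? f xs)
  ... | no _  = count-map P? f xs

  count-mono : {P Q : A → Set} (P? : Decidable P) (Q? : Decidable Q) (xs : List A) →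
               (∀ {x} → x ∈ xs → P x → Q x) → count P? xs ≤ count Q? xs
  count-mono P? Q? [] _ = z≤n
  count-mono P? Q? (x ∷ xs) P⇒Q with P? x | Q? x
  ... | yes px | yes _  = s≤s (count-mono P? Q? xs (λ x∈ → P⇒Q (there x∈)))
  ... | yes px | no ¬qx = ⊥-elim (¬qx (P⇒Q (here refl) px))
  ... | no _   | yes _  = m≤n⇒m≤1+n (count-mono P? Q? xs (λ x∈ → P⇒Q (there x∈)))
  ... | no _   | no _   = count-mono P? Q? xs (λ x∈ → P⇒Q (there x∈))

  count-none : {P : A → Set} (P? : Decidable P) (xs : List A) →
               (∀ {x} → x ∈ xs → ¬ P x) → count P? xs ≡ 0
  count-none P? xs ¬P = cong length (filter-none P? (tabulate ¬P))

  sum-map-+ : (f g : B → ℕ) (us : List B) →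
              sum (map (λ u → f u + g u) us) ≡ sum (map f us) + sum (map g us)
  sum-map-+ f g [] = refl
  sum-map-+ f g (u ∷ us) = trans (cong (f u + g u +_) (sum-map-+ f g us)) (interchange (f u) (g u) _ _)

  sum-map-*ˡ : (c : ℕ) (f : B → ℕ) (us : List B) →
               sum (map (λ u → c * f u) us) ≡ c * sum (map f us)
  sum-map-*ˡ c f [] = sym (*-zeroʳ c)
  sum-map-*ˡ c f (u ∷ us) = trans (cong (c * f u +_) (sum-map-*ˡ c f us)) (sym (*-distribˡ-+ c (f u) _))

  sum-map-≤-length* : (f : B → ℕ) (c : ℕ) (us : List B) →
                      (∀ {u} → u ∈ us → f u ≤ c) → sum (map f us) ≤ length us * c
  sum-map-≤-length* f c [] _ = z≤n
  sum-map-≤-length* f c (u ∷ us) f≤c =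
    +-mono-≤ (f≤c (here refl)) (sum-map-≤-length* f c us (λ u∈ → f≤c (there u∈)))

  1≤sum-indicator : {P : A → Set} (P? : Decidable P) {xs : List A} →
                    Any P xs → 1 ≤ sum (map (λ x → indicator (P? x)) xs)
  1≤sum-indicator P? {x ∷ _} (here px) with P? x
  ... | yes _ = s≤s z≤n
  ... | no ¬px = ⊥-elim (¬px px)
  1≤sum-indicator P? {x ∷ _} (there any) = ≤-trans (1≤sum-indicator P? any) (m≤n+m _ (indicator (P? x)))

  sum-map-≤-indicator : {P : A → Set} (f : A → ℕ) (a b : ℕ) (P? : Decidable P) (xs : List A) →
    (∀ {x} → x ∈ xs → f x ≤ a * indicator (P? x) + b) → sum (map f xs) ≤ a * count P? xs + b * length xs
  sum-map-≤-indicator f a b P? [] _ = z≤n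
  sum-map-≤-indicator f a b P? (x ∷ xs) f≤ = begin
    f x + sum (map f xs)
      ≤⟨ +-mono-≤ (f≤ (here refl)) (sum-map-≤-indicator f a b P? xs (λ x∈ → f≤ (there x∈))) ⟩
    (a * indicator (P? x) + b) + (a * count P? xs + b * length xs)
      ≡⟨ solve 5 (λ a b i c l → (a :* i :+ b) :+ (a :* c :+ b :* l) := a :* (i :+ c) :+ b :* (con 1 :+ l))
               refl a b (indicator (P? x)) (count P? xs) (length xs) ⟩
    a * (indicator (P? x) + count P? xs) + b * suc (length xs)
      ≡⟨ cong (λ c → a * c + b * suc (length xs)) (count-∷ P? x xs) ⟨
    a * count P? (x ∷ xs) + b * length (x ∷ xs) ∎
    where open ≤-Reasoning

  count-≤-sum-count : {P : A → Set} (P? : Decidable P) {R : B → A → Set} (R? : ∀ u → Decidable (R u))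
    (us : List B) (xs : List A) → (∀ {x} → x ∈ xs → P x → Any (λ u → R u x) us) →
    count P? xs ≤ sum (map (λ u → count (R? u) xs) us)
  count-≤-sum-count P? R? us [] _ = z≤n
  count-≤-sum-count P? {R} R? us (x ∷ xs) covered = begin
    count P? (x ∷ xs)
      ≡⟨ count-∷ P? x xs ⟩
    indicator (P? x) + count P? xs
      ≤⟨ +-mono-≤ indicator≤ (count-≤-sum-count P? R? us xs (λ x∈ → covered (there x∈))) ⟩
    sum (map (λ u → indicator (R? u x)) us) + sum (map (λ u → count (R? u) xs) us)
      ≡⟨ sum-map-+ _ _ us ⟨
    sum (map (λ u → indicator (R? u x) + count (R? u) xs) us)
      ≡⟨ cong sum (map-cong (λ u → count-∷ (R? u) x xs) us) ⟨
    sum (map (λ u → count (R? u) (x ∷ xs)) us) ∎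
    where
    open ≤-Reasoning
    indicator≤ : indicator (P? x) ≤ sum (map (λ u → indicator (R? u x)) us)
    indicator≤ with P? x
    ... | yes px = 1≤sum-indicator (λ u → R? u x) (covered (here refl) px)
    ... | no _ = z≤n

  Unique⇒lookup-injective : {xs : List A} → Unique xs → Injective _≡_ _≡_ (lookup xs)
  Unique⇒lookup-injective (x≢ ∷ _) {zero}  {zero}  _  = refl
  Unique⇒lookup-injective (x≢ ∷ _) {zero}  {suc j} eq = ⊥-elim (All.lookup x≢ (∈-lookup j) eq)
  Unique⇒lookup-injective (x≢ ∷ _) {suc i} {zero}  eq = ⊥-elim (All.lookup x≢ (∈-lookup i) (sym eq))
  Unique⇒lookup-injective (_ ∷ u)  {suc i} {suc j} eq = cong suc (Unique⇒lookup-injective u eq)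

  Unique⇒length-mono-⊆ : {xs ys : List A} → Unique xs → xs ⊆ ys → length xs ≤ length ys
  Unique⇒length-mono-⊆ {xs = xs} {ys} u xs⊆ys = injective⇒≤ {f = position} position-injective
    where
    open ≡-Reasoning
    position : Fin (length xs) → Fin (length ys)
    position i = Any.index (xs⊆ys (∈-lookup i))
    position-injective : Injective _≡_ _≡_ position
    position-injective {i} {j} eq = Unique⇒lookup-injective u (begin
      lookup xs i            ≡⟨ lookup-index (xs⊆ys (∈-lookup i)) ⟩
      lookup ys (position i) ≡⟨ cong (lookup ys) eq ⟩
      lookup ys (position j) ≡⟨ lookup-index (xs⊆ys (∈-lookup j)) ⟨
      lookup xs j            ∎)

  count-mono-⊆ : {P : A → Set} (P? : Decidable P) {xs ys : List A} →
                 Unique xs → xs ⊆ ys → count P? xs ≤ count P? ys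
  count-mono-⊆ P? u xs⊆ys = Unique⇒length-mono-⊆ (Unique.filter⁺ P? u)
    (λ x∈ → let (x∈xs , px) = ∈-filter⁻ P? x∈ in ∈-filter⁺ P? (xs⊆ys x∈xs) px)

module SubsetCounting where

  open ListCounting

  open import Data.Nat using (ℕ; zero; suc; _+_; _*_; _^_; _≤_; z≤n; _!; _≟_)
  open import Data.Nat.Properties
  open import Data.Fin using (Fin; zero; suc)
  open import Data.Fin.Subset using (Subset; inside; outside; ∣_∣; _⊆_; _∪_; ⁅_⁆; ⊥; Nonempty)
    renaming (_∈_ to _∈ₛ_; _∉_ to _∉ₛ_)
  open import Data.Fin.Subset.Properties
    using (_⊆?_; _∈?_; nonempty?; drop-∷-⊆; ⊆-min; p⊆q⇒∣p∣≤∣q∣; ∪-identityʳ; x∈p∪q⁻; x∈⁅y⁆⇒x≡y;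
           ∣⊥∣≡0; ∣⁅x⁆∣≡1; Empty-unique)
  open import Data.Vec using ([]; _∷_; here; there)
  open import Data.List using (List; []; _∷_; map; length; concatMap)
  open import Data.List.Properties using (length-map; length-++)
  open import Data.List.Membership.Propositional using (_∈_)
  open import Data.List.Membership.Propositional.Properties
    using (∈-++⁺ˡ; ∈-++⁺ʳ; ∈-map⁺; ∈-map⁻; ∈-filter⁻)
  open import Data.List.Relation.Unary.Any using (here; there)
  open import Data.List.Relation.Unary.All using (All; []; _∷_)
  open import Data.List.Relation.Unary.AllPairs using ([]; _∷_)
  open import Data.List.Relation.Unary.Unique.Propositional using (Unique)
  import Data.List.Relation.Unary.Unique.Propositional.Properties as Unique
  open import Data.Product using (_×_; _,_; proj₂)
  open import Data.Sum using (inj₁; inj₂)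
  open import Data.Empty using (⊥-elim)
  open import Function using (_∘_; case_of_)
  open import Relation.Nullary using (Dec; ¬_)
  open import Relation.Nullary.Decidable using (_×-dec_; decidable-stable)
  open import Relation.Unary using (Decidable)
  open import Relation.Binary.PropositionalEquality using (_≡_; _≢_; refl; sym; trans; cong; cong₂; subst)
  open import Data.Nat.Solver using (module +-*-Solver)
  open +-*-Solver

  allSubsets-complete : ∀ {n} (A : Subset n) → A ∈ allSubsets n
  allSubsets-complete [] = here refl
  allSubsets-complete {suc n} (inside ∷ A) = ∈-++⁺ˡ (∈-map⁺ (inside ∷_) (allSubsets-complete A))
  allSubsets-complete {suc n} (outside ∷ A) =
    ∈-++⁺ʳ (map (inside ∷_) (allSubsets n)) (∈-map⁺ (outside ∷_) (allSubsets-complete A))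

  allSubsets-unique : ∀ n → Unique (allSubsets n)
  allSubsets-unique zero = [] ∷ []
  allSubsets-unique (suc n) = Unique.++⁺ (Unique.map⁺ tail-injective (allSubsets-unique n))
    (Unique.map⁺ tail-injective (allSubsets-unique n)) heads-differ
    where
    tail-injective : ∀ {b} {A B : Subset n} → b ∷ A ≡ b ∷ B → A ≡ B
    tail-injective refl = refl
    heads-differ : ∀ {A} → ¬ (A ∈ map (inside ∷_) (allSubsets n) × A ∈ map (outside ∷_) (allSubsets n))
    heads-differ (A∈ , A∈′) with ∈-map⁻ (inside ∷_) A∈ | ∈-map⁻ (outside ∷_) A∈′
    ... | _ , _ , refl | _ , _ , ()

  count-allSubsets-suc : ∀ {n} {P : Subset (suc n) → Set} (P? : Decidable P) →
    count P? (allSubsets (suc n)) ≡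
    count (P? ∘ (inside ∷_)) (allSubsets n) + count (P? ∘ (outside ∷_)) (allSubsets n)
  count-allSubsets-suc {n} P? = trans (count-++ P? (map (inside ∷_) (allSubsets n)) _)
    (cong₂ _+_ (count-map P? (inside ∷_) (allSubsets n)) (count-map P? (outside ∷_) (allSubsets n)))

  module _ {n : ℕ} {P : Subset (suc n) → Set} (P? : Decidable P) where

    count-allSubsets-suc-≤ : {Q R : Subset n → Set} (Q? : Decidable Q) (R? : Decidable R) →
      (∀ {A} → P (inside ∷ A) → Q A) → (∀ {A} → P (outside ∷ A) → R A) →
      count P? (allSubsets (suc n)) ≤ count Q? (allSubsets n) + count R? (allSubsets n)
    count-allSubsets-suc-≤ Q? R? P⇒Q P⇒R = ≤-trans (≤-reflexive (count-allSubsets-suc P?))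
      (+-mono-≤ (count-mono _ Q? (allSubsets n) (λ _ → P⇒Q)) (count-mono _ R? (allSubsets n) (λ _ → P⇒R)))

    count-allSubsets-suc-inside : {Q : Subset n → Set} (Q? : Decidable Q) →
      (∀ {A} → P (inside ∷ A) → Q A) → (∀ {A} → ¬ P (outside ∷ A)) →
      count P? (allSubsets (suc n)) ≤ count Q? (allSubsets n)
    count-allSubsets-suc-inside Q? P⇒Q ¬P = begin
      count P? (allSubsets (suc n))
        ≡⟨ count-allSubsets-suc P? ⟩
      count (P? ∘ (inside ∷_)) (allSubsets n) + count (P? ∘ (outside ∷_)) (allSubsets n)
        ≡⟨ cong (count (P? ∘ (inside ∷_)) (allSubsets n) +_) (count-none _ (allSubsets n) (λ _ → ¬P)) ⟩
      count (P? ∘ (inside ∷_)) (allSubsets n) + 0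
        ≤⟨ +-monoˡ-≤ 0 (count-mono _ Q? (allSubsets n) (λ _ → P⇒Q)) ⟩
      count Q? (allSubsets n) + 0
        ≡⟨ +-identityʳ _ ⟩
      count Q? (allSubsets n) ∎
      where open ≤-Reasoning

    count-allSubsets-suc-outside : {Q : Subset n → Set} (Q? : Decidable Q) →
      (∀ {A} → ¬ P (inside ∷ A)) → (∀ {A} → P (outside ∷ A) → Q A) →
      count P? (allSubsets (suc n)) ≤ count Q? (allSubsets n)
    count-allSubsets-suc-outside Q? ¬P P⇒Q = begin
      count P? (allSubsets (suc n))
        ≡⟨ count-allSubsets-suc P? ⟩
      count (P? ∘ (inside ∷_)) (allSubsets n) + count (P? ∘ (outside ∷_)) (allSubsets n)
        ≡⟨ cong (_+ count (P? ∘ (outside ∷_)) (allSubsets n)) (count-none _ (allSubsets n) (λ _ → ¬P)) ⟩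
      count (P? ∘ (outside ∷_)) (allSubsets n)
        ≤⟨ count-mono _ Q? (allSubsets n) (λ _ → P⇒Q) ⟩
      count Q? (allSubsets n) ∎
      where open ≤-Reasoning

  Extends : ∀ {n} → ℕ → Subset n → Subset n → Set
  Extends j T A = ∣ A ∣ ≡ ∣ T ∣ + j × T ⊆ A

  extends? : ∀ {n} (j : ℕ) (T A : Subset n) → Dec (Extends j T A)
  extends? j T A = (∣ A ∣ ≟ ∣ T ∣ + j) ×-dec (T ⊆? A)

  extensionCount : (n j : ℕ) → Subset n → ℕ
  extensionCount n j T = count (extends? j T) (allSubsets n)

  binomial-lower-bound : ∀ i n → suc i * n ^ i + n ^ suc i ≤ suc n ^ suc i
  binomial-lower-bound zero n = ≤-reflexive (solve 1 (λ n → con 1 :+ n :* con 1 := (con 1 :+ n) :* con 1) refl n)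
  binomial-lower-bound (suc i) n = begin
    suc (suc i) * (n * n ^ i) + n * (n * n ^ i)
      ≤⟨ m≤m+n _ (suc i * n ^ i) ⟩
    suc (suc i) * (n * n ^ i) + n * (n * n ^ i) + suc i * n ^ i
      ≡⟨ solve 3 (λ i n x → (con 2 :+ i) :* (n :* x) :+ n :* (n :* x) :+ (con 1 :+ i) :* x
                            := (con 1 :+ n) :* ((con 1 :+ i) :* x :+ n :* x)) refl i n (n ^ i) ⟩
    suc n * (suc i * n ^ i + n ^ suc i)
      ≤⟨ *-monoʳ-≤ (suc n) (binomial-lower-bound i n) ⟩
    suc n * suc n ^ suc i ∎
    where open ≤-Reasoning

  extensionCount-bound : ∀ n j (T : Subset n) → extensionCount n j T * j ! ≤ n ^ j
  extensionCount-bound zero zero [] = ≤-refl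
  extensionCount-bound zero (suc j) [] = z≤n
  extensionCount-bound (suc n) j (inside ∷ T) = begin
    extensionCount (suc n) j (inside ∷ T) * j !
      ≤⟨ *-monoˡ-≤ (j !) (count-allSubsets-suc-inside (extends? j (inside ∷ T)) (extends? j T)
           (λ (e , T⊆A) → suc-injective e , drop-∷-⊆ T⊆A) (λ (_ , T⊆A) → case T⊆A here of λ ())) ⟩
    extensionCount n j T * j !
      ≤⟨ extensionCount-bound n j T ⟩
    n ^ j
      ≤⟨ ^-monoˡ-≤ j (n≤1+n n) ⟩
    suc n ^ j ∎
    where open ≤-Reasoning
  extensionCount-bound (suc n) zero (outside ∷ T) = begin
    extensionCount (suc n) 0 (outside ∷ T) * 1
      ≤⟨ *-monoˡ-≤ 1 (count-allSubsets-suc-outside (extends? 0 (outside ∷ T)) (extends? 0 T)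
           (λ (e , T⊆A) → <⇒≱ (≤-reflexive (trans e (+-identityʳ _)))
                                (p⊆q⇒∣p∣≤∣q∣ (drop-∷-⊆ T⊆A)))
           (λ (e , T⊆A) → e , drop-∷-⊆ T⊆A)) ⟩
    extensionCount n 0 T * 1
      ≤⟨ extensionCount-bound n 0 T ⟩
    1 ∎
    where open ≤-Reasoning
  extensionCount-bound (suc n) (suc j) (outside ∷ T) = begin
    extensionCount (suc n) (suc j) (outside ∷ T) * suc j !
      ≤⟨ *-monoˡ-≤ (suc j !) (count-allSubsets-suc-≤ (extends? (suc j) (outside ∷ T))
                                (extends? j T) (extends? (suc j) T)
           (λ (e , T⊆A) → suc-injective (trans e (+-suc _ j)) , drop-∷-⊆ T⊆A)
           (λ (e , T⊆A) → e , drop-∷-⊆ T⊆A)) ⟩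
    (fewer + same) * suc j !
      ≡⟨ solve 4 (λ a b j f → (a :+ b) :* ((con 1 :+ j) :* f)
                            := (con 1 :+ j) :* (a :* f) :+ b :* ((con 1 :+ j) :* f))
               refl fewer same j (j !) ⟩
    suc j * (fewer * j !) + same * suc j !
      ≤⟨ +-mono-≤ (*-monoʳ-≤ (suc j) (extensionCount-bound n j T)) (extensionCount-bound n (suc j) T) ⟩
    suc j * n ^ j + n ^ suc j
      ≤⟨ binomial-lower-bound j n ⟩
    suc n ^ suc j ∎
    where
    open ≤-Reasoning
    fewer = extensionCount n j T
    same = extensionCount n (suc j) T

  count≤extensionCount : ∀ {n j} {T : Subset n} {P : Subset n → Set} (P? : Decidable P) {Fs : List (Subset n)} →
    Unique Fs → (∀ {F} → F ∈ Fs → P F → Extends j T F) → count P? Fs ≤ extensionCount n j T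
  count≤extensionCount {j = j} {T} P? {Fs} unique P⇒Extends = ≤-trans (count-mono P? (extends? j T) Fs P⇒Extends)
    (count-mono-⊆ (extends? j T) unique (λ {A} _ → allSubsets-complete A))

  kSubsets-unique : ∀ n r → Unique (kSubsets n r)
  kSubsets-unique n r = Unique.filter⁺ (λ A → ∣ A ∣ ≟ r) (allSubsets-unique n)

  ∈-kSubsets⁻ : ∀ {n r} {E : Subset n} → E ∈ kSubsets n r → ∣ E ∣ ≡ r
  ∈-kSubsets⁻ {n} {r} E∈ = proj₂ (∈-filter⁻ (λ A → ∣ A ∣ ≟ r) {xs = allSubsets n} E∈)

  count-kSubsets≤extensionCount : ∀ {n r j} {T : Subset n} {P : Subset n → Set} (P? : Decidable P) →
    (∀ {E} → ∣ E ∣ ≡ r → P E → Extends j T E) → count P? (kSubsets n r) ≤ extensionCount n j T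
  count-kSubsets≤extensionCount P? P⇒Extends =
    count≤extensionCount P? (kSubsets-unique _ _) (λ E∈ → P⇒Extends (∈-kSubsets⁻ E∈))

  m≤m*n! : ∀ m n → m ≤ m * n !
  m≤m*n! m n = m≤m*n m (n !) {{n !≢0}}

  length-kSubsets : ∀ n r → length (kSubsets n r) ≤ n ^ r
  length-kSubsets n r = begin
    count (λ A → ∣ A ∣ ≟ r) (allSubsets n)
      ≤⟨ count-mono _ (extends? r ⊥) (allSubsets n)
           (λ {A} _ e → trans e (cong (_+ r) (sym (∣⊥∣≡0 n))) , ⊆-min A) ⟩
    extensionCount n r ⊥
      ≤⟨ m≤m*n! _ r ⟩
    extensionCount n r ⊥ * r !
      ≤⟨ extensionCount-bound n r ⊥ ⟩
    n ^ r ∎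
    where open ≤-Reasoning

  ⁅⁆-⊆ : ∀ {n} {x : Fin n} {A : Subset n} → x ∈ₛ A → ⁅ x ⁆ ⊆ A
  ⁅⁆-⊆ {x = x} x∈A y∈⁅x⁆ = subst (_∈ₛ _) (sym (x∈⁅y⁆⇒x≡y x y∈⁅x⁆)) x∈A

  ∪⁅⁆-⊆ : ∀ {n} {T A : Subset n} {x : Fin n} → T ⊆ A → x ∈ₛ A → T ∪ ⁅ x ⁆ ⊆ A
  ∪⁅⁆-⊆ {T = T} {x = x} T⊆A x∈A {y} y∈ with x∈p∪q⁻ T ⁅ x ⁆ y∈
  ... | inj₁ y∈T = T⊆A y∈T
  ... | inj₂ y∈⁅x⁆ = ⁅⁆-⊆ x∈A y∈⁅x⁆

  ∣p∪⁅x⁆∣≡1+∣p∣ : ∀ {n} (p : Subset n) (x : Fin n) → x ∉ₛ p → ∣ p ∪ ⁅ x ⁆ ∣ ≡ suc ∣ p ∣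
  ∣p∪⁅x⁆∣≡1+∣p∣ (inside ∷ p) zero x∉p = ⊥-elim (x∉p here)
  ∣p∪⁅x⁆∣≡1+∣p∣ (outside ∷ p) zero x∉p = cong (suc ∘ ∣_∣) (∪-identityʳ p)
  ∣p∪⁅x⁆∣≡1+∣p∣ (inside ∷ p) (suc x) x∉p = cong suc (∣p∪⁅x⁆∣≡1+∣p∣ p x (x∉p ∘ there))
  ∣p∪⁅x⁆∣≡1+∣p∣ (outside ∷ p) (suc x) x∉p = ∣p∪⁅x⁆∣≡1+∣p∣ p x (x∉p ∘ there)

  ∣⁅u⁆∪⁅v⁆∣≡2 : ∀ {n} {u v : Fin n} → u ≢ v → ∣ ⁅ u ⁆ ∪ ⁅ v ⁆ ∣ ≡ 2
  ∣⁅u⁆∪⁅v⁆∣≡2 {u = u} {v} u≢v =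
    trans (∣p∪⁅x⁆∣≡1+∣p∣ ⁅ u ⁆ v (u≢v ∘ sym ∘ x∈⁅y⁆⇒x≡y u)) (cong suc (∣⁅x⁆∣≡1 u))

  count-∋-kSubsets : ∀ n r (u : Fin n) → count (u ∈?_) (kSubsets n (suc r)) * r ! ≤ n ^ r
  count-∋-kSubsets n r u = begin
    count (u ∈?_) (kSubsets n (suc r)) * r !
      ≤⟨ *-monoˡ-≤ (r !) (count-kSubsets≤extensionCount (u ∈?_)
           (λ e u∈E → trans e (cong (_+ r) (sym (∣⁅x⁆∣≡1 u))) , ⁅⁆-⊆ u∈E)) ⟩
    extensionCount n r ⁅ u ⁆ * r !
      ≤⟨ extensionCount-bound n r ⁅ u ⁆ ⟩
    n ^ r ∎
    where open ≤-Reasoning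

  count-∋∋-kSubsets : ∀ n r {u v : Fin n} → u ≢ v →
                      n * count (λ E → (u ∈? E) ×-dec (v ∈? E)) (kSubsets n (suc r)) ≤ n ^ r
  count-∋∋-kSubsets n zero {u} {v} u≢v = ≤-trans (≤-reflexive (trans (cong (n *_) none) (*-zeroʳ n))) z≤n
    where
    none : count (λ E → (u ∈? E) ×-dec (v ∈? E)) (kSubsets n 1) ≡ 0
    none = count-none _ (kSubsets n 1) (λ E∈ (u∈E , v∈E) →
      <⇒≱ (≤-reflexive (sym (∣⁅u⁆∪⁅v⁆∣≡2 u≢v)))
          (≤-trans (p⊆q⇒∣p∣≤∣q∣ (∪⁅⁆-⊆ (⁅⁆-⊆ u∈E) v∈E)) (≤-reflexive (∈-kSubsets⁻ E∈))))
  count-∋∋-kSubsets n (suc r) {u} {v} u≢v = *-monoʳ-≤ n (begin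
    count (λ E → (u ∈? E) ×-dec (v ∈? E)) (kSubsets n (suc (suc r)))
      ≤⟨ count-kSubsets≤extensionCount {n} {suc (suc r)} {r} _ (λ e (u∈E , v∈E) →
           trans e (cong (_+ r) (sym (∣⁅u⁆∪⁅v⁆∣≡2 u≢v))) , ∪⁅⁆-⊆ (⁅⁆-⊆ u∈E) v∈E) ⟩
    extensionCount n r (⁅ u ⁆ ∪ ⁅ v ⁆)
      ≤⟨ m≤m*n! _ r ⟩
    extensionCount n r (⁅ u ⁆ ∪ ⁅ v ⁆) * r !
      ≤⟨ extensionCount-bound n r (⁅ u ⁆ ∪ ⁅ v ⁆) ⟩
    n ^ r ∎)
    where open ≤-Reasoning

  elements : ∀ {n} → Subset n → List (Fin n)
  elements [] = []
  elements (inside ∷ p) = zero ∷ map suc (elements p)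
  elements (outside ∷ p) = map suc (elements p)

  length-elements : ∀ {n} (p : Subset n) → length (elements p) ≡ ∣ p ∣
  length-elements [] = refl
  length-elements (inside ∷ p) = cong suc (trans (length-map suc (elements p)) (length-elements p))
  length-elements (outside ∷ p) = trans (length-map suc (elements p)) (length-elements p)

  ∈-elements⁺ : ∀ {n} {p : Subset n} {x} → x ∈ₛ p → x ∈ elements p
  ∈-elements⁺ {p = inside ∷ p} here = here refl
  ∈-elements⁺ {p = inside ∷ p} (there x∈p) = there (∈-map⁺ suc (∈-elements⁺ x∈p))
  ∈-elements⁺ {p = outside ∷ p} (there x∈p) = ∈-map⁺ suc (∈-elements⁺ x∈p)

  ∈-elements⁻ : ∀ {n} {p : Subset n} {x} → x ∈ elements p → x ∈ₛ p
  ∈-elements⁻ {p = inside ∷ p} (here refl) = here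
  ∈-elements⁻ {p = inside ∷ p} (there x∈) with ∈-map⁻ suc x∈
  ... | _ , y∈ , refl = there (∈-elements⁻ y∈)
  ∈-elements⁻ {p = outside ∷ p} x∈ with ∈-map⁻ suc x∈
  ... | _ , y∈ , refl = there (∈-elements⁻ y∈)

  length-concatMap-elements : ∀ {n k} (Fs : List (Subset n)) → All (λ F → ∣ F ∣ ≡ k) Fs →
    length (concatMap elements Fs) ≡ length Fs * k
  length-concatMap-elements [] [] = refl
  length-concatMap-elements (F ∷ Fs) (∣F∣≡k ∷ ∣Fs∣≡k) = trans (length-++ (elements F))
    (cong₂ _+_ (trans (length-elements F) ∣F∣≡k) (length-concatMap-elements Fs ∣Fs∣≡k))

  ∣p∣≡1+m⇒Nonempty : ∀ {n m} {p : Subset n} → ∣ p ∣ ≡ suc m → Nonempty p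
  ∣p∣≡1+m⇒Nonempty {n} {p = p} ∣p∣≡1+m = decidable-stable (nonempty? p) λ p-empty →
    0≢1+n (trans (sym (∣⊥∣≡0 n)) (trans (cong ∣_∣ (sym (Empty-unique p-empty))) ∣p∣≡1+m))

module Stability where

  open ListCounting
  open SubsetCounting

  open import Data.Nat using (ℕ; suc; _+_; _*_; _^_; _≤_; _<_; _!; _<?_; _≤?_; NonZero)
  open import Data.Nat.Properties
  open import Data.Nat.ListAction using (sum)
  open import Data.Fin using (Fin)
  import Data.Fin as Fin
  open import Data.Fin.Subset using (Subset; ∣_∣; _⊆_; _∪_; _∩_; ⁅_⁆; Nonempty)
    renaming (_∈_ to _∈ₛ_; _∉_ to _∉ₛ_)
  open import Data.Fin.Subset.Properties using (_⊆?_; _∈?_; x∈p∩q⁺; x∈p∩q⁻; nonempty?)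
  open import Data.List
    using (List; []; _∷_; _++_; map; filter; length; concatMap; deduplicate; allFin; lookup; take)
  open import Data.List.Properties using (length-++; length-take)
  open import Data.List.Membership.Propositional using (_∈_; _∉_; lose; find)
  open import Data.List.Membership.Propositional.Properties
    using (∈-++⁻; ∈-++⁺ˡ; ∈-filter⁺; ∈-filter⁻; ∈-allFin; ∈-concatMap⁺; ∈-deduplicate⁺; ∈-deduplicate⁻)
  open import Data.List.Relation.Unary.Unique.DecPropositional.Properties using (deduplicate-!)
  open import Data.List.Relation.Unary.Any using (Any; here; there; any?)
  import Data.List.Relation.Unary.Any as Any
  open import Data.List.Relation.Unary.Any.Properties using (lookup-index)
  open import Data.List.Relation.Unary.All using (All; []; _∷_; all?)
  import Data.List.Relation.Unary.All as All
  open import Data.List.Relation.Unary.All.Properties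
    using (¬Any⇒All¬; ¬All⇒Any¬; All¬⇒¬Any; ++⁻ˡ; ++⁻ʳ; all-filter; take⁺)
  open import Data.List.Relation.Unary.AllPairs using (AllPairs; []; _∷_)
  open import Data.List.Relation.Unary.Unique.Propositional using (Unique)
  import Data.List.Relation.Unary.Unique.Propositional.Properties as Unique
  open import Data.Product using (Σ; ∃; ∃-syntax; _×_; _,_; proj₁)
  open import Function.Definitions using (Injective)
  open import Function.Bundles using (_⇔_; mk⇔)
  open import Data.Sum using (_⊎_; inj₁; inj₂)
  open import Data.Empty using (⊥-elim)
  open import Function using (id; _∘_; case_of_)
  open import Relation.Nullary using (Dec; yes; no; ¬_)
  open import Relation.Nullary.Decidable using (_×-dec_; ¬?; decidable-stable)
  open import Relation.Binary.PropositionalEquality using (_≡_; refl; sym; trans; cong; cong₂; subst)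
  open import Data.Nat.Solver using (module +-*-Solver)
  open +-*-Solver

  UnionOfStars : ∀ {n} → List (Subset n) → ℕ → Set
  UnionOfStars {n} H s = Σ (Fin s → Fin n) λ x → Injective _≡_ _≡_ x ×
    Σ (Fin s → List (Subset n)) λ G →
      ((i : Fin s) → All (λ F → x i ∈ₛ F) (G i)) ×
      ((F : Subset n) → (F ∈ H) ⇔ (∃[ i ] (F ∈ G i)))

  hitting-set⇒UnionOfStars : ∀ {n} (H : List (Subset n)) (vs : List (Fin n)) → Unique vs →
    (∀ {F} → F ∈ H → Any (_∈ₛ F) vs) → UnionOfStars H (length vs)
  hitting-set⇒UnionOfStars H vs vs-unique hits =
    lookup vs , Unique⇒lookup-injective vs-unique , star , star-centred ,
    λ F → mk⇔ (λ F∈H → let i = Any.index (hits F∈H)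
                       in i , ∈-filter⁺ (lookup vs i ∈?_) F∈H (lookup-index (hits F∈H)))
              (λ (i , F∈star) → proj₁ (∈-filter⁻ (lookup vs i ∈?_) F∈star))
    where
    star : Fin (length vs) → List (Subset _)
    star i = filter (lookup vs i ∈?_) H
    star-centred : ∀ i → All (lookup vs i ∈ₛ_) (star i)
    star-centred i = all-filter (lookup vs i ∈?_) H

  disjoint? : ∀ {n} (F G : Subset n) → Dec (Disjoint F G)
  disjoint? F G = ¬? (nonempty? (F ∩ G))

  greedyMatching : ∀ {n} → List (Subset n) → List (Subset n) → List (Subset n)
  greedyMatching M [] = M
  greedyMatching M (F ∷ Fs) with all? (disjoint? F) M
  ... | yes _ = greedyMatching (F ∷ M) Fs
  ... | no _ = greedyMatching M Fs

  module _ {n : ℕ} where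

    greedyMatching-All : {P : Subset n → Set} (M Fs : List (Subset n)) →
                         All P M → All P Fs → All P (greedyMatching M Fs)
    greedyMatching-All M [] PM _ = PM
    greedyMatching-All M (F ∷ Fs) PM (PF ∷ PFs) with all? (disjoint? F) M
    ... | yes _ = greedyMatching-All (F ∷ M) Fs (PF ∷ PM) PFs
    ... | no _ = greedyMatching-All M Fs PM PFs

    greedyMatching-disjoint : (M Fs : List (Subset n)) →
                              AllPairs Disjoint M → AllPairs Disjoint (greedyMatching M Fs)
    greedyMatching-disjoint M [] M-disjoint = M-disjoint
    greedyMatching-disjoint M (F ∷ Fs) M-disjoint with all? (disjoint? F) M
    ... | yes F-disjoint = greedyMatching-disjoint (F ∷ M) Fs (F-disjoint ∷ M-disjoint)
    ... | no _ = greedyMatching-disjoint M Fs M-disjoint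

    greedyMatching-⊇ : (M Fs : List (Subset n)) {G : Subset n} → G ∈ M → G ∈ greedyMatching M Fs
    greedyMatching-⊇ M [] G∈M = G∈M
    greedyMatching-⊇ M (F ∷ Fs) G∈M with all? (disjoint? F) M
    ... | yes _ = greedyMatching-⊇ (F ∷ M) Fs (there G∈M)
    ... | no _ = greedyMatching-⊇ M Fs G∈M

    greedyMatching-maximal : (M Fs : List (Subset n)) {F : Subset n} → F ∈ Fs → Nonempty F →
      ∃ λ G → G ∈ greedyMatching M Fs × Nonempty (F ∩ G)
    greedyMatching-maximal M (F ∷ Fs) (here refl) (x , x∈F) with all? (disjoint? F) M
    ... | yes _ = F , greedyMatching-⊇ (F ∷ M) Fs (here refl) , x , x∈p∩q⁺ (x∈F , x∈F)
    ... | no ¬disjoint =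
      let (G , G∈M , ¬F∩G-empty) = find (¬All⇒Any¬ (disjoint? F) M ¬disjoint)
      in G , greedyMatching-⊇ M Fs G∈M , decidable-stable (nonempty? (F ∩ G)) ¬F∩G-empty
    greedyMatching-maximal M (F′ ∷ Fs) (there F∈Fs) F-nonempty with all? (disjoint? F′) M
    ... | yes _ = greedyMatching-maximal (F′ ∷ M) Fs F∈Fs F-nonempty
    ... | no _ = greedyMatching-maximal M Fs F∈Fs F-nonempty

  -- At most k + (k+1)s vertices are ever avoided in the greedy construction of big-vertices-cover.
  heavyThreshold : ℕ → ℕ → ℕ
  heavyThreshold k s = k + suc k * s

  lowerOrderCoefficient : ℕ → ℕ → ℕ → ℕ
  lowerOrderCoefficient r s p = D * r ! * (s * suc (suc r)) + r ! * D ^ p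
    where D = heavyThreshold (suc (suc r)) s

  module Family (n r s : ℕ) (H : List (Subset n)) (H-unique : Unique H)
    (H-uniform : All (λ F → ∣ F ∣ ≡ suc (suc r)) H)
    (ν≤s : (L : List (Subset n)) → All (_∈ H) L → AllPairs Disjoint L → length L ≤ s) where

    k : ℕ
    k = suc (suc r)

    K : List (Subset n)
    K = kSubsets n (suc r)

    D : ℕ
    D = heavyThreshold k s

    Heavy : Subset n → Set
    Heavy E = D < deg H E

    heavy? : (E : Subset n) → Dec (Heavy E)
    heavy? E = D <? deg H E

    heavyDegree : Fin n → ℕ
    heavyDegree v = count (λ E → (v ∈? E) ×-dec heavy? E) K

    -- v lies in more than D·n^(r-1) heavy sets, multiplied out by n to avoid division and the case r = 0.
    Big : Fin n → Set
    Big v = D * n ^ r < n * heavyDegree v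

    big? : (v : Fin n) → Dec (Big v)
    big? v = D * n ^ r <? n * heavyDegree v

    Meets : Subset n → List (Fin n) → Set
    Meets F S = Any (_∈ₛ F) S

    meets? : (F : Subset n) (S : List (Fin n)) → Dec (Meets F S)
    meets? F S = any? (_∈? F) S

    Avoids : Subset n → List (Fin n) → Set
    Avoids F S = All (_∉ₛ F) S

    avoids? : (F : Subset n) (S : List (Fin n)) → Dec (Avoids F S)
    avoids? F S = all? (λ u → ¬? (u ∈? F)) S

    ∈H⇒∣F∣≡k : ∀ {F} → F ∈ H → ∣ F ∣ ≡ k
    ∈H⇒∣F∣≡k = All.lookup H-uniform

    count-H≤extensionCount : ∀ j (T : Subset n) {P : Subset n → Set} (P? : ∀ F → Dec (P F)) →
      ∣ T ∣ + j ≡ k → (∀ {F} → P F → T ⊆ F) → count P? H ≤ extensionCount n j T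
    count-H≤extensionCount j T P? ∣T∣+j≡k P⇒⊇T =
      count≤extensionCount P? H-unique (λ F∈H PF → trans (∈H⇒∣F∣≡k F∈H) (sym ∣T∣+j≡k) , P⇒⊇T PF)

    deg≤n : ∀ {E} → ∣ E ∣ ≡ suc r → deg H E ≤ n
    deg≤n {E} ∣E∣≡1+r = begin
      deg H E
        ≤⟨ count-H≤extensionCount 1 E (E ⊆?_) (trans (+-comm _ 1) (cong suc ∣E∣≡1+r)) id ⟩
      extensionCount n 1 E     ≡⟨ *-identityʳ _ ⟨
      extensionCount n 1 E * 1 ≤⟨ extensionCount-bound n 1 E ⟩
      n * 1                    ≡⟨ *-identityʳ n ⟩
      n                        ∎
      where open ≤-Reasoning

    count-⊇∋≤1 : ∀ {E u} → ∣ E ∣ ≡ suc r → u ∉ₛ E →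
                 count (λ F → (E ⊆? F) ×-dec (u ∈? F)) H ≤ 1
    count-⊇∋≤1 {E} {u} ∣E∣≡1+r u∉E = begin
      count (λ F → (E ⊆? F) ×-dec (u ∈? F)) H
        ≤⟨ count-H≤extensionCount 0 (E ∪ ⁅ u ⁆) _
             (trans (+-identityʳ _) (trans (∣p∪⁅x⁆∣≡1+∣p∣ E u u∉E) (cong suc ∣E∣≡1+r)))
             (λ (E⊆F , u∈F) → ∪⁅⁆-⊆ E⊆F u∈F) ⟩
      extensionCount n 0 (E ∪ ⁅ u ⁆)     ≡⟨ *-identityʳ _ ⟨
      extensionCount n 0 (E ∪ ⁅ u ⁆) * 1 ≤⟨ extensionCount-bound n 0 (E ∪ ⁅ u ⁆) ⟩
      1 ∎
      where open ≤-Reasoning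

    count-⊇-meeting≤length : ∀ {E} (S : List (Fin n)) → ∣ E ∣ ≡ suc r → Avoids E S →
      count (λ F → (E ⊆? F) ×-dec meets? F S) H ≤ length S
    count-⊇-meeting≤length {E} S ∣E∣≡1+r E-avoids = begin
      count (λ F → (E ⊆? F) ×-dec meets? F S) H
        ≤⟨ count-≤-sum-count _ (λ u F → (E ⊆? F) ×-dec (u ∈? F)) S H
             (λ _ (E⊆F , meets) → Any.map (λ u∈F → (λ {x} → E⊆F {x}) , u∈F) meets) ⟩
      sum (map (λ u → count (λ F → (E ⊆? F) ×-dec (u ∈? F)) H) S)
        ≤⟨ sum-map-≤-length* _ 1 S (λ u∈S → count-⊇∋≤1 ∣E∣≡1+r (All.lookup E-avoids u∈S)) ⟩
      length S * 1
        ≡⟨ *-identityʳ _ ⟩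
      length S ∎
      where open ≤-Reasoning

    ¬Avoids⇒Meets : ∀ F S → ¬ Avoids F S → Meets F S
    ¬Avoids⇒Meets F S ¬avoids with meets? F S
    ... | yes meets = meets
    ... | no ¬meets = ⊥-elim (¬avoids (¬Any⇒All¬ S ¬meets))

    heavy⇒avoiding-edge : ∀ {E} (S : List (Fin n)) → E ∈ K → Heavy E → Avoids E S → length S ≤ D →
      ∃ λ F → F ∈ H × Avoids F S
    heavy⇒avoiding-edge {E} S E∈K heavy E-avoids |S|≤D with any? (λ F → avoids? F S) H
    ... | yes found = find found
    ... | no none = ⊥-elim (<⇒≱ heavy (begin
      deg H E
        ≤⟨ count-mono (E ⊆?_) (λ F → (E ⊆? F) ×-dec meets? F S) H
             (λ {F} F∈H E⊆F → E⊆F , ¬Avoids⇒Meets F S (none ∘ lose F∈H)) ⟩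
      count (λ F → (E ⊆? F) ×-dec meets? F S) H
        ≤⟨ count-⊇-meeting≤length S (∈-kSubsets⁻ E∈K) E-avoids ⟩
      length S
        ≤⟨ |S|≤D ⟩
      D ∎))
      where open ≤-Reasoning

    big⇒avoiding-edge : ∀ {v} (S : List (Fin n)) → Big v → v ∉ S → length S ≤ D →
                        ∃ λ F → F ∈ H × Avoids F S
    big⇒avoiding-edge {v} S big v∉S |S|≤D with any? (λ E → heavy? E ×-dec avoids? E S) K
    ... | yes found =
      let (E , E∈K , heavy , E-avoids) = find found in heavy⇒avoiding-edge S E∈K heavy E-avoids |S|≤D
    ... | no none = ⊥-elim (<⇒≱ big (begin
      n * heavyDegree v
        ≤⟨ *-monoʳ-≤ n (count-≤-sum-count _ (λ u E → (v ∈? E) ×-dec (u ∈? E)) S K covered) ⟩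
      n * sum (map pairDegree S)
        ≡⟨ sum-map-*ˡ n pairDegree S ⟨
      sum (map (λ u → n * pairDegree u) S)
        ≤⟨ sum-map-≤-length* _ (n ^ r) S (λ u∈S → count-∋∋-kSubsets n r (λ { refl → v∉S u∈S })) ⟩
      length S * n ^ r
        ≤⟨ *-monoˡ-≤ (n ^ r) |S|≤D ⟩
      D * n ^ r ∎))
      where
      open ≤-Reasoning
      pairDegree : Fin n → ℕ
      pairDegree u = count (λ E → (v ∈? E) ×-dec (u ∈? E)) K
      covered : ∀ {E} → E ∈ K → v ∈ₛ E × Heavy E → Any (λ u → v ∈ₛ E × u ∈ₛ E) S
      covered E∈K (v∈E , heavy) =
        Any.map (v∈E ,_) (¬Avoids⇒Meets _ S (λ E-avoids → none (lose E∈K (heavy , E-avoids))))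

    avoids⇒disjoint : ∀ F G {S} → (∀ {x} → x ∈ₛ F → x ∈ S) → Avoids G S → Disjoint F G
    avoids⇒disjoint F G F⊆S G-avoids (x , x∈F∩G) =
      let (x∈F , x∈G) = x∈p∩q⁻ F G x∈F∩G in All.lookup G-avoids (F⊆S x∈F) x∈G

    -- Each pending big vertex reserves k + 1 places of the budget D: its own, and those of its edge.
    disjoint-avoiding-edges : (vs : List (Fin n)) → Unique vs → All Big vs → (S : List (Fin n)) → All (_∉ S) vs →
      length S + suc k * length vs ≤ D →
      ∃ λ Fs → length Fs ≡ length vs × All (_∈ H) Fs × AllPairs Disjoint Fs × All (λ F → Avoids F S) Fs
    disjoint-avoiding-edges [] _ _ S _ _ = [] , refl , [] , [] , []
    disjoint-avoiding-edges (v ∷ vs) (v∉vs ∷ vs-unique) (big ∷ bigs) S (v∉S ∷ vs∉S) budget =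
      let (F , F∈H , F-avoids) = big⇒avoiding-edge (vs ++ S) big v∉vs++S budget-now
          (Fs , |Fs|≡|vs| , Fs⊆H , Fs-disjoint , Fs-avoid) =
            disjoint-avoiding-edges vs vs-unique bigs (elements F ++ S) (vs∉F++S F-avoids) (budget-later F∈H)
      in F ∷ Fs , cong suc |Fs|≡|vs| , F∈H ∷ Fs⊆H ,
         All.map (avoids⇒disjoint F _ (∈-++⁺ˡ ∘ ∈-elements⁺)) Fs-avoid ∷ Fs-disjoint ,
         ++⁻ʳ vs F-avoids ∷ All.map (++⁻ʳ (elements F)) Fs-avoid
      where
      open ≤-Reasoning
      v∉vs++S : v ∉ vs ++ S
      v∉vs++S v∈ with ∈-++⁻ vs v∈
      ... | inj₁ v∈vs = All.lookup v∉vs v∈vs refl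
      ... | inj₂ v∈S = v∉S v∈S
      vs∉F++S : ∀ {F} → Avoids F (vs ++ S) → All (_∉ elements F ++ S) vs
      vs∉F++S {F} F-avoids = All.tabulate λ {w} w∈vs w∈ → case ∈-++⁻ (elements F) w∈ of λ where
        (inj₁ w∈F) → All.lookup (++⁻ˡ vs F-avoids) w∈vs (∈-elements⁻ w∈F)
        (inj₂ w∈S) → All.lookup vs∉S w∈vs w∈S
      budget-now : length (vs ++ S) ≤ D
      budget-now = begin
        length (vs ++ S)
          ≡⟨ trans (length-++ vs) (+-comm (length vs) _) ⟩
        length S + length vs
          ≤⟨ +-monoʳ-≤ (length S) (≤-trans (n≤1+n _) (m≤n*m (suc (length vs)) (suc k))) ⟩
        length S + suc k * suc (length vs)
          ≤⟨ budget ⟩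
        D ∎
      budget-later : ∀ {F} → F ∈ H → length (elements F ++ S) + suc k * length vs ≤ D
      budget-later {F} F∈H = begin
        length (elements F ++ S) + suc k * length vs
          ≡⟨ cong (_+ suc k * length vs) (trans (length-++ (elements F))
               (cong (_+ length S) (trans (length-elements F) (∈H⇒∣F∣≡k F∈H)))) ⟩
        k + length S + suc k * length vs
          ≤⟨ n≤1+n _ ⟩
        suc (k + length S + suc k * length vs)
          ≡⟨ solve 3 (λ k l v → con 1 :+ (k :+ l :+ (con 1 :+ k) :* v) := l :+ (con 1 :+ k) :* (con 1 :+ v))
                   refl k (length S) (length vs) ⟩
        length S + suc k * suc (length vs)
          ≤⟨ budget ⟩
        D ∎

    big-vertices-cover : (vs : List (Fin n)) → Unique vs → All Big vs → length vs ≡ s →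
                         ∀ {F} → F ∈ H → Meets F vs
    big-vertices-cover vs vs-unique bigs |vs|≡s {F} F∈H = ¬Avoids⇒Meets F vs λ F-avoids →
      let (Fs , |Fs|≡|vs| , Fs⊆H , Fs-disjoint , Fs-avoid) =
            disjoint-avoiding-edges vs vs-unique bigs (elements F) (All.map (_∘ ∈-elements⁻) F-avoids) budget
      in 1+n≰n (subst (λ m → suc m ≤ s) (trans |Fs|≡|vs| |vs|≡s)
           (ν≤s (F ∷ Fs) (F∈H ∷ Fs⊆H) (All.map (avoids⇒disjoint F _ ∈-elements⁺) Fs-avoid ∷ Fs-disjoint)))
      where
      budget : length (elements F) + suc k * length vs ≤ D
      budget = ≤-reflexive (cong₂ (λ a b → a + suc k * b)
                                  (trans (length-elements F) (∈H⇒∣F∣≡k F∈H)) |vs|≡s)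

    matching : List (Subset n)
    matching = greedyMatching [] H

    matching⊆H : All (_∈ H) matching
    matching⊆H = greedyMatching-All [] H [] (All.tabulate id)

    cover : List (Fin n)
    cover = deduplicate Fin._≟_ (concatMap elements matching)

    cover-unique : Unique cover
    cover-unique = deduplicate-! Fin._≟_ (concatMap elements matching)

    cover-meets : ∀ {F} → F ∈ H → Meets F cover
    cover-meets {F} F∈H =
      let (G , G∈matching , x , x∈F∩G) =
            greedyMatching-maximal [] H F∈H (∣p∣≡1+m⇒Nonempty (∈H⇒∣F∣≡k F∈H))
          (x∈F , x∈G) = x∈p∩q⁻ F G x∈F∩G
      in lose (∈-deduplicate⁺ Fin._≟_ (∈-concatMap⁺ elements (lose G∈matching (∈-elements⁺ x∈G)))) x∈F

    length-cover : length cover ≤ s * k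
    length-cover = begin
      length cover
        ≤⟨ Unique⇒length-mono-⊆ cover-unique (∈-deduplicate⁻ Fin._≟_ (concatMap elements matching)) ⟩
      length (concatMap elements matching)
        ≡⟨ length-concatMap-elements matching (All.map ∈H⇒∣F∣≡k matching⊆H) ⟩
      length matching * k
        ≤⟨ *-monoˡ-≤ k (ν≤s matching matching⊆H (greedyMatching-disjoint [] H [])) ⟩
      s * k ∎
      where open ≤-Reasoning

    heavy-meets-cover : ∀ {E} → E ∈ K → Heavy E → Meets E cover
    heavy-meets-cover {E} E∈K heavy = ¬Avoids⇒Meets E cover λ E-avoids →
      let (F , F∈H , F-avoids) = heavy⇒avoiding-edge cover E∈K heavy E-avoids |cover|≤D
      in All¬⇒¬Any F-avoids (cover-meets F∈H)
      where
      |cover|≤D : length cover ≤ D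
      |cover|≤D = ≤-trans length-cover
        (≤-trans (≤-reflexive (*-comm s k)) (≤-trans (*-monoˡ-≤ s (n≤1+n k)) (m≤n+m _ k)))

    heavyCount : ℕ
    heavyCount = count heavy? K

    bigVertices : List (Fin n)
    bigVertices = filter big? (allFin n)

    cod≤heavyCount : ∀ p → cod n k p H ≤ n ^ p * heavyCount + D ^ p * n ^ suc r
    cod≤heavyCount p = begin
      cod n k p H
        ≤⟨ sum-map-≤-indicator (λ E → deg H E ^ p) (n ^ p) (D ^ p) heavy? K degree-bound ⟩
      n ^ p * heavyCount + D ^ p * length K
        ≤⟨ +-monoʳ-≤ (n ^ p * heavyCount) (*-monoʳ-≤ (D ^ p) (length-kSubsets n (suc r))) ⟩
      n ^ p * heavyCount + D ^ p * n ^ suc r ∎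
      where
      open ≤-Reasoning
      degree-bound : ∀ {E} → E ∈ K → deg H E ^ p ≤ n ^ p * indicator (heavy? E) + D ^ p
      degree-bound {E} E∈K with heavy? E
      ... | yes _ = ≤-trans (^-monoˡ-≤ p (deg≤n (∈-kSubsets⁻ E∈K)))
                            (≤-trans (≤-reflexive (sym (*-identityʳ _))) (m≤m+n _ _))
      ... | no ¬heavy = ≤-trans (^-monoˡ-≤ p (≮⇒≥ ¬heavy)) (m≤n+m _ _)

    heavyCount≤bigVertices : n * r ! * heavyCount ≤ n ^ suc r * length bigVertices + D * n ^ r * r ! * length cover
    heavyCount≤bigVertices = begin
      n * r ! * heavyCount
        ≤⟨ *-monoʳ-≤ (n * r !) (count-≤-sum-count heavy? (λ u E → (u ∈? E) ×-dec heavy? E) cover K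
             (λ E∈K heavy → Any.map (_, heavy) (heavy-meets-cover E∈K heavy))) ⟩
      n * r ! * sum (map heavyDegree cover)
        ≡⟨ sum-map-*ˡ (n * r !) heavyDegree cover ⟨
      sum (map (λ u → n * r ! * heavyDegree u) cover)
        ≤⟨ sum-map-≤-indicator _ (n ^ suc r) (D * n ^ r * r !) big? cover (λ _ → heavyDegree-bound) ⟩
      n ^ suc r * count big? cover + D * n ^ r * r ! * length cover
        ≤⟨ +-monoˡ-≤ _ (*-monoʳ-≤ (n ^ suc r) (count-mono-⊆ big? cover-unique (λ {u} _ → ∈-allFin u))) ⟩
      n ^ suc r * length bigVertices + D * n ^ r * r ! * length cover ∎
      where
      open ≤-Reasoning
      heavyDegree-bound : ∀ {u} → n * r ! * heavyDegree u ≤ n ^ suc r * indicator (big? u) + D * n ^ r * r !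
      heavyDegree-bound {u} with big? u
      ... | yes _ = begin
        n * r ! * heavyDegree u
          ≡⟨ solve 3 (λ n f h → n :* f :* h := n :* (h :* f)) refl n (r !) (heavyDegree u) ⟩
        n * (heavyDegree u * r !)
          ≤⟨ *-monoʳ-≤ n (≤-trans (*-monoˡ-≤ (r !) (count-mono _ (u ∈?_) K (λ _ → proj₁)))
                                  (count-∋-kSubsets n r u)) ⟩
        n ^ suc r
          ≤⟨ ≤-trans (≤-reflexive (sym (*-identityʳ _))) (m≤m+n _ _) ⟩
        n ^ suc r * 1 + D * n ^ r * r ! ∎
      ... | no ¬big = begin
        n * r ! * heavyDegree u
          ≡⟨ solve 3 (λ n f h → n :* f :* h := f :* (n :* h)) refl n (r !) (heavyDegree u) ⟩
        r ! * (n * heavyDegree u)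
          ≤⟨ *-monoʳ-≤ (r !) (≮⇒≥ ¬big) ⟩
        r ! * (D * n ^ r)
          ≡⟨ *-comm (r !) _ ⟩
        D * n ^ r * r !
          ≤⟨ m≤n+m _ _ ⟩
        n ^ suc r * 0 + D * n ^ r * r ! ∎

    few-big-vertices⇒small-cod : ∀ p x .{{_ : NonZero n}} → 2 ≤ p → length bigVertices ≤ x →
      n * r ! * cod n k p H ≤ n * n ^ (r + p) * x + n ^ (r + p) * lowerOrderCoefficient r s p
    few-big-vertices⇒small-cod p x 2≤p |B|≤x = begin
      n * r ! * cod n k p H
        ≤⟨ *-monoʳ-≤ (n * r !) (cod≤heavyCount p) ⟩
      n * r ! * (n ^ p * heavyCount + D ^ p * n ^ suc r)
        ≡⟨ solve 6 (λ n c P h Q M → n :* c :* (P :* h :+ Q :* M) := P :* (n :* c :* h) :+ c :* Q :* (n :* M))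
                 refl n (r !) (n ^ p) heavyCount (D ^ p) (n ^ suc r) ⟩
      n ^ p * (n * r ! * heavyCount) + r ! * D ^ p * n ^ suc (suc r)
        ≤⟨ +-mono-≤ (*-monoʳ-≤ (n ^ p) heavyCount≤bigVertices)
                    (*-monoʳ-≤ (r ! * D ^ p) (^-monoʳ-≤ n 2+r≤r+p)) ⟩
      n ^ p * (n ^ suc r * length bigVertices + D * n ^ r * r ! * length cover) + r ! * D ^ p * N
        ≤⟨ +-monoˡ-≤ _ (*-monoʳ-≤ (n ^ p) (+-mono-≤ (*-monoʳ-≤ (n ^ suc r) |B|≤x)
                                                   (*-monoʳ-≤ (D * n ^ r * r !) length-cover))) ⟩
      n ^ p * (n * n ^ r * x + D * n ^ r * r ! * (s * k)) + r ! * D ^ p * N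
        ≡⟨ solve 9 (λ n P R x D c L N Q → P :* (n :* R :* x :+ D :* R :* c :* L) :+ c :* Q :* N
                                       := n :* (P :* R) :* x :+ (P :* R) :* (D :* c :* L) :+ N :* (c :* Q))
                 refl n (n ^ p) (n ^ r) x D (r !) (s * k) N (D ^ p) ⟩
      n * (n ^ p * n ^ r) * x + (n ^ p * n ^ r) * (D * r ! * (s * k)) + N * (r ! * D ^ p)
        ≡⟨ cong (λ m → n * m * x + m * (D * r ! * (s * k)) + N * (r ! * D ^ p)) n^p*n^r≡N ⟩
      n * N * x + N * (D * r ! * (s * k)) + N * (r ! * D ^ p)
        ≡⟨ trans (+-assoc (n * N * x) _ _) (cong (n * N * x +_) (sym (*-distribˡ-+ N _ _))) ⟩
      n * N * x + N * lowerOrderCoefficient r s p ∎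
      where
      open ≤-Reasoning
      N = n ^ (r + p)
      2+r≤r+p : 2 + r ≤ r + p
      2+r≤r+p = ≤-trans (≤-reflexive (+-comm 2 r)) (+-monoʳ-≤ r 2≤p)
      n^p*n^r≡N : n ^ p * n ^ r ≡ N
      n^p*n^r≡N = trans (sym (^-distribˡ-+-* n p r)) (cong (n ^_) (+-comm p r))

    stars-or-small-cod : ∀ p x .{{_ : NonZero n}} → 2 ≤ p → s ≡ suc x →
      UnionOfStars H s ⊎ n * r ! * cod n k p H ≤ n * n ^ (r + p) * x + n ^ (r + p) * lowerOrderCoefficient r s p
    stars-or-small-cod p x 2≤p s≡1+x with s ≤? length bigVertices
    ... | yes s≤|B| = inj₁ (subst (UnionOfStars H) |vs|≡s
                       (hitting-set⇒UnionOfStars H vs vs-unique (big-vertices-cover vs vs-unique vs-big |vs|≡s)))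
      where
      vs = take s bigVertices
      |vs|≡s : length vs ≡ s
      |vs|≡s = trans (length-take s bigVertices) (m≤n⇒m⊓n≡m s≤|B|)
      vs-unique : Unique vs
      vs-unique = Unique.take⁺ s (Unique.filter⁺ big? (Unique.allFin⁺ n))
      vs-big : All Big vs
      vs-big = take⁺ s (all-filter big? (allFin n))
    ... | no s≰|B| = inj₂ (few-big-vertices⇒small-cod p x 2≤p
                             (≤-pred (subst (suc (length bigVertices) ≤_) s≡1+x (≰⇒> s≰|B|))))

module Threshold where

  open import Data.Nat using (suc; _+_; _*_; _≤_; NonZero; >-nonZero)
  open import Data.Nat.Properties
  open import Data.Nat.Coprimality using (Coprime)
  open import Data.Integer using (ℤ; +_)
  import Data.Integer as ℤ
  open import Data.Integer.Properties using (pos-+; pos-*; drop‿+≤+)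
  open import Data.Rational using (mkℚ; _/_; toℚᵘ) renaming (_+_ to _+ℚ_; _*_ to _*ℚ_; _≤_ to _≤ℚ_)
  open import Data.Rational.Properties using (toℚᵘ-mono-≤; toℚᵘ-homo-+; toℚᵘ-homo-*; toℚᵘ-fromℚᵘ)
  open import Data.Rational.Unnormalised using (mkℚᵘ; *≤*)
    renaming (_+_ to _+ᵘ_; _*_ to _*ᵘ_; _≤_ to _≤ᵘ_; _≃_ to _≃ᵘ_)
  open import Data.Rational.Unnormalised.Properties
    using (≃-trans; ≃-refl; +-cong; *-cong; ≤-respˡ-≃; ≤-respʳ-≃)
  open import Relation.Binary.PropositionalEquality
    using (_≡_; refl; sym; trans; cong; cong₂; subst₂; module ≡-Reasoning)
  open import Data.Nat.Solver using (module +-*-Solver)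
  open +-*-Solver

  toℚᵘ-/ : ∀ (m : ℤ) d-1 → toℚᵘ (m / suc d-1) ≃ᵘ mkℚᵘ m d-1
  toℚᵘ-/ m d-1 = toℚᵘ-fromℚᵘ (mkℚᵘ m d-1)

  threshold≤⇒ : ∀ x c .{{_ : NonZero c}} a b-1 .(a⊥b : Coprime a (suc b-1)) N Y →
    ((+ x / c) +ℚ mkℚ (+ a) b-1 a⊥b) *ℚ (+ N / 1) ≤ℚ (+ Y / 1) →
    x * suc b-1 * N + a * c * N ≤ suc b-1 * c * Y
  threshold≤⇒ x (suc c-1) a b-1 a⊥b N Y ≤Y =
    clear-denominators (≤-respʳ-≃ (toℚᵘ-/ (+ Y) 0) (≤-respˡ-≃ lhs≃ (toℚᵘ-mono-≤ ≤Y)))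
    where
    b = suc b-1
    c = suc c-1
    lhs≃ : toℚᵘ (((+ x / c) +ℚ mkℚ (+ a) b-1 a⊥b) *ℚ (+ N / 1)) ≃ᵘ
           (mkℚᵘ (+ x) c-1 +ᵘ mkℚᵘ (+ a) b-1) *ᵘ mkℚᵘ (+ N) 0
    lhs≃ = ≃-trans (toℚᵘ-homo-* ((+ x / c) +ℚ mkℚ (+ a) b-1 a⊥b) (+ N / 1))
             (*-cong (≃-trans (toℚᵘ-homo-+ (+ x / c) (mkℚ (+ a) b-1 a⊥b)) (+-cong (toℚᵘ-/ (+ x) c-1) ≃-refl))
                     (toℚᵘ-/ (+ N) 0))
    numerator : + ((x * b + a * c) * N * 1) ≡ (+ x ℤ.* + b ℤ.+ + a ℤ.* + c) ℤ.* + N ℤ.* + 1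
    numerator = begin
      + ((x * b + a * c) * N * 1)               ≡⟨ pos-* ((x * b + a * c) * N) 1 ⟩
      + ((x * b + a * c) * N) ℤ.* + 1           ≡⟨ cong (ℤ._* + 1) (pos-* (x * b + a * c) N) ⟩
      + (x * b + a * c) ℤ.* + N ℤ.* + 1         ≡⟨ cong (λ z → z ℤ.* + N ℤ.* + 1) (pos-+ (x * b) (a * c)) ⟩
      (+ (x * b) ℤ.+ + (a * c)) ℤ.* + N ℤ.* + 1
        ≡⟨ cong (λ z → z ℤ.* + N ℤ.* + 1) (cong₂ ℤ._+_ (pos-* x b) (pos-* a c)) ⟩
      (+ x ℤ.* + b ℤ.+ + a ℤ.* + c) ℤ.* + N ℤ.* + 1 ∎
      where open ≡-Reasoning
    clear-denominators : (mkℚᵘ (+ x) c-1 +ᵘ mkℚᵘ (+ a) b-1) *ᵘ mkℚᵘ (+ N) 0 ≤ᵘ mkℚᵘ (+ Y) 0 →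
                         x * b * N + a * c * N ≤ b * c * Y
    clear-denominators (*≤* ≤ℤ) = subst₂ _≤_
      (solve 5 (λ x b a c N → (x :* b :+ a :* c) :* N :* con 1 := x :* b :* N :+ a :* c :* N) refl x b a c N)
      (solve 3 (λ Y c b → Y :* (c :* b :* con 1) := b :* c :* Y) refl Y c b)
      (drop‿+≤+ (subst₂ ℤ._≤_ (sym numerator) (sym (pos-* Y _)) ≤ℤ))

  above-threshold⇒bounded : ∀ {n N x a b c cod K} .{{_ : NonZero N}} → 1 ≤ a → 1 ≤ c →
    x * b * N + a * c * N ≤ b * c * cod → n * c * cod ≤ n * N * x + N * K → n ≤ b * K
  above-threshold⇒bounded {n} {N} {x} {a} {b} {c} {cod} {K} 1≤a 1≤c threshold upper = begin
    n           ≤⟨ m≤m*n n (a * c) {{>-nonZero (*-mono-≤ 1≤a 1≤c)}} ⟩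
    n * (a * c) ≤⟨ *-cancelʳ-≤ _ _ N (+-cancelˡ-≤ (x * b * (n * N)) _ _ scaled) ⟩
    b * K       ∎
    where
    open ≤-Reasoning
    scaled : x * b * (n * N) + n * (a * c) * N ≤ x * b * (n * N) + b * K * N
    scaled = begin
      x * b * (n * N) + n * (a * c) * N
        ≡⟨ solve 6 (λ n N x a b c → x :* b :* (n :* N) :+ n :* (a :* c) :* N
                                   := n :* (x :* b :* N :+ a :* c :* N)) refl n N x a b c ⟩
      n * (x * b * N + a * c * N)
        ≤⟨ *-monoʳ-≤ n threshold ⟩
      n * (b * c * cod)
        ≡⟨ solve 4 (λ n b c d → n :* (b :* c :* d) := b :* (n :* c :* d)) refl n b c cod ⟩
      b * (n * c * cod)
        ≤⟨ *-monoʳ-≤ b upper ⟩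
      b * (n * N * x + N * K)
        ≡⟨ solve 5 (λ n N x b K → b :* (n :* N :* x :+ N :* K) := x :* b :* (n :* N) :+ b :* K :* N)
                 refl n N x b K ⟩
      x * b * (n * N) + b * K * N ∎

open Stability
open Threshold

open import Data.Nat using (ℕ; _≤_; _≥_)
open import Data.Integer using (+_)
open import Data.Rational using (ℚ; 0ℚ; _/_; _<_)
open import Data.Product using (Σ; ∃-syntax; _×_)
open import Data.Fin using (Fin)
open import Data.Fin.Subset using (Subset; ∣_∣) renaming (_∈_ to _∈ₛ_)
open import Data.List using (List; length)
open import Data.List.Membership.Propositional using (_∈_)
open import Data.List.Relation.Unary.All using (All)
open import Data.List.Relation.Unary.AllPairs using (AllPairs)
open import Data.List.Relation.Unary.Unique.Propositional using (Unique)
open import Function.Definitions using (Injective)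
open import Relation.Binary.PropositionalEquality using (_≡_)
open import Function.Bundles using (_⇔_)

open import Data.Nat using (suc; z≤n; s≤s; _+_; _*_; _!; >-nonZero)
open import Data.Nat.Properties using (<⇒≱; ≤-trans; 1≤n!; m^n≢0; _!≢0)
open import Data.Integer using (-[1+_]; +<+)
open import Data.Rational using (mkℚ; *<*)
open import Data.Product using (_,_)
open import Data.Sum using ([_,_]′)
open import Function using (id)
open import Relation.Nullary using (contradiction)
open import Relation.Binary.PropositionalEquality using (refl)

theorem2p2 : (k s p : ℕ) → 1 ≤ s → 2 ≤ k → 2 ≤ p →
    (ε : ℚ) → 0ℚ < ε →
    ∃[ nε ] ((n : ℕ) → n ≥ nε →
      (H : List (Subset n)) → Unique H → All (λ F → ∣ F ∣ ≡ k) H →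
      ((L : List (Subset n)) → All (_∈ H) L → AllPairs Disjoint L → length L ≤ s) →
      threshold n k s p ε Data.Rational.≤ ((+ cod n k p H) / 1) →
      Σ (Fin s → Fin n) λ x → Injective _≡_ _≡_ x ×
        Σ (Fin s → List (Subset n)) λ G →
          ((i : Fin s) → All (λ F → x i ∈ₛ F) (G i)) ×
          ((F : Subset n) → (F ∈ H) ⇔ (∃[ i ] (F ∈ G i))))
theorem2p2 (suc (suc r)) s@(suc s₀) p (s≤s z≤n) (s≤s (s≤s z≤n)) 2≤p (mkℚ (+ a@(suc _)) b-1 a⊥b) _ =
  suc (suc b-1 * lowerOrderCoefficient r s p) , λ n bK<n H H-unique H-uniform ν≤s above-threshold →
    let open Family n r s H H-unique H-uniform ν≤s
        instance
          n≢0 = >-nonZero (≤-trans (s≤s z≤n) bK<n)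
          nʳ⁺ᵖ≢0 = m^n≢0 n (r + p)
          r!≢0 = r !≢0
    in [ id , (λ small-cod → contradiction (above-threshold⇒bounded {a = a} (s≤s z≤n) (1≤n! r)
                  (threshold≤⇒ s₀ (r !) a b-1 a⊥b _ _ above-threshold) small-cod) (<⇒≱ bK<n)) ]′
       (stars-or-small-cod p s₀ 2≤p refl)
theorem2p2 (suc (suc r)) (suc s₀) p (s≤s z≤n) (s≤s (s≤s z≤n)) _ (mkℚ (+ 0) _ _) (*<* (+<+ ()))
theorem2p2 (suc (suc r)) (suc s₀) p (s≤s z≤n) (s≤s (s≤s z≤n)) _ (mkℚ -[1+ _ ] _ _) (*<* ())
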